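{- Let $T$ be a text whose last character is a sentinel $\$$ occurring nowhere else, and let $S$ be a string. Let $r(S) := \{y\in\Sigma\cup\{\$\} : f(Sy)=1\}$. If $|r(S)| = 0$, then $\phi(S) = 0$.
   Context: $\Sigma$ is a constant-size alphabet not containing $\$$. For a text $T$ of length $n$, $T[i\ldots j]$ is the substring from position $i$ to $j$, and $f(P)$ is the number of occurrences of a string $P$ in $T$. An occurrence $(i,j)$ is a net occurrence if $f(T[i\ldots j])\ge 2$, $f(T[i-1\ldots j])=1$ and $f(T[i\ldots j+1])=1$, where the second condition is considered true when $i=1$ and the third when $j=n$. The net frequency $\phi(S)$ is the number of net occurrences $(i,j)$ with $T[i\ldots j]=S$ (it is $0$ if $S$ is not repeated). -}

module Defs where

open import Data.Nat using (ℕ; zero; suc; _+_; _≤_; _≥_)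
open import Data.Nat.Properties using () renaming (_≟_ to _≟ℕ_; _≤?_ to _≤?ℕ_)
open import Data.Fin using (Fin)
open import Data.Fin.Properties using () renaming (_≟_ to _≟F_)
open import Data.Maybe using (Maybe; just; nothing)
open import Data.Maybe.Properties using () renaming (≡-dec to ≡-decMaybe)
open import Data.List using (List; []; _∷_; _++_; [_]; take; drop; length; filter; upTo; map; allFin)
open import Data.List.Properties using () renaming (≡-dec to ≡-decList)
open import Data.Product using (_×_; _,_; ∃)
open import Data.Sum using (_⊎_)
open import Data.Unit using (⊤; tt)
open import Relation.Binary.PropositionalEquality using (_≡_)
open import Relation.Nullary using (Dec; yes; no)
open import Relation.Nullary.Decidable using (_×-dec_; _⊎-dec_)
open import Relation.Binary using (DecidableEquality)

-- Alphabet Σ = Fin k (constant size k); extended alphabet Σ ∪ {$} = Maybe (Fin k),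
-- where `nothing` plays the role of the sentinel $ (so $ ∉ Σ).
Char : ℕ → Set
Char k = Maybe (Fin k)

$ : ∀ {k} → Char k
$ = nothing

allChars : (k : ℕ) → List (Char k)
allChars k = $ ∷ map just (allFin k)

_≟C_ : ∀ {k} → DecidableEquality (Char k)
_≟C_ = ≡-decMaybe _≟F_

_≟S_ : ∀ {k} → DecidableEquality (List (Char k))
_≟S_ = ≡-decList _≟C_

SentinelText : ∀ {k} → List (Char k) → Set
SentinelText {k} T = ∃ λ (w : List (Fin k)) → T ≡ map just w ++ [ $ ]

-- Positions are 0-indexed: P occurs in T starting at position i
-- (i.e. T[i+1 .. i+|P|] = P in the paper's 1-indexed notation).
OccursAt : ∀ {k} → List (Char k) → List (Char k) → ℕ → Set
OccursAt T P i = (i + length P ≤ length T) × (take (length P) (drop i T) ≡ P)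

occursAt? : ∀ {k} (T P : List (Char k)) (i : ℕ) → Dec (OccursAt T P i)
occursAt? T P i = ((i + length P) ≤?ℕ length T) ×-dec (take (length P) (drop i T) ≟S P)

freq : ∀ {k} → List (Char k) → List (Char k) → ℕ
freq T P = length (filter (occursAt? T P) (upTo (length T)))

-- left-maximality condition: i = start (paper's i = 1), or f(T[i-1..j]) = 1
LeftCond : ∀ {k} → List (Char k) → List (Char k) → ℕ → Set
LeftCond T S zero = ⊤
LeftCond T S (suc i) = freq T (take (suc (length S)) (drop i T)) ≡ 1

leftCond? : ∀ {k} (T S : List (Char k)) (i : ℕ) → Dec (LeftCond T S i)
leftCond? T S zero = yes tt
leftCond? T S (suc i) = freq T (take (suc (length S)) (drop i T)) ≟ℕ 1

RightCond : ∀ {k} → List (Char k) → List (Char k) → ℕ → Set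
RightCond T S i = (i + length S ≡ length T) ⊎ (freq T (take (suc (length S)) (drop i T)) ≡ 1)

rightCond? : ∀ {k} (T S : List (Char k)) (i : ℕ) → Dec (RightCond T S i)
rightCond? T S i = ((i + length S) ≟ℕ length T) ⊎-dec (freq T (take (suc (length S)) (drop i T)) ≟ℕ 1)

NetOcc : ∀ {k} → List (Char k) → List (Char k) → ℕ → Set
NetOcc T S i = OccursAt T S i × (freq T S ≥ 2) × LeftCond T S i × RightCond T S i

netOcc? : ∀ {k} (T S : List (Char k)) (i : ℕ) → Dec (NetOcc T S i)
netOcc? T S i = occursAt? T S i ×-dec ((2 ≤?ℕ freq T S) ×-dec (leftCond? T S i ×-dec rightCond? T S i))

netFreq : ∀ {k} → List (Char k) → List (Char k) → ℕ
netFreq T S = length (filter (netOcc? T S) (upTo (length T)))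

-- r(S) = { y ∈ Σ ∪ {$} : f(Sy) = 1 }, as a duplicate-free list
rightSet : ∀ {k} → List (Char k) → List (Char k) → List (Char k)
rightSet {k} T S = filter (λ y → freq T (S ++ [ y ]) ≟ℕ 1) (allChars k)

module Submission where

open import Defs
open import Data.Nat using (ℕ; zero; suc; pred; _+_; _≤_; _<_; z≤n; s≤s)
open import Data.Nat.Properties
  using (<⇒≱; ≤-reflexive; <-irrefl; m≤n⇒m<n∨m≡n; +-cancelʳ-≡; +-identityʳ; ≤-pred)
  renaming (_≟_ to _≟ℕ_)
open import Data.Fin using (Fin)
open import Data.Maybe using (just; nothing)
open import Data.List using (List; []; _∷_; _++_; [_]; take; drop; length; filter; upTo; map)
open import Data.List.Properties using (filter-none)
open import Data.List.Membership.Propositional using (_∈_; _∉_)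
open import Data.List.Membership.Propositional.Properties
  using (∈-filter⁺; ∈-filter⁻; ∈-map⁺; ∈-allFin; ∈-upTo⁻)
open import Data.List.Relation.Unary.Any using (here; there)
open import Data.List.Relation.Unary.All as All using (All)
open import Data.List.Relation.Unary.AllPairs using (_∷_)
open import Data.List.Relation.Unary.Unique.Propositional using (Unique)
open import Data.List.Relation.Unary.Unique.Propositional.Properties using (upTo⁺; filter⁺)
open import Data.Product using (_,_; ∃; proj₂)
open import Data.Sum using (_⊎_; inj₁; inj₂)
open import Data.Empty using (⊥-elim)
open import Level using (0ℓ)
open import Relation.Nullary using (¬_)
open import Relation.Unary using (Pred; Decidable)
open import Relation.Binary.PropositionalEquality using (_≡_; refl; sym; trans; cong; subst)

-- If S occurs at i, the paper's right condition f(T[i..j+1]) = 1 speaks either about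
-- S itself (when j = n, take cannot grow) or about some one-character extension Sy.
-- Since r(S) is empty the second alternative is impossible, so f(S) ≤ 1 unless S is a
-- suffix of T; a repeated suffix is excluded by the sentinel, as every occurrence of a
-- suffix contains $, which occurs only at the last position.

take-suc-⊎ : ∀ {A : Set} (m : ℕ) (xs : List A) →
  take (suc m) xs ≡ take m xs ⊎ ∃ λ y → take (suc m) xs ≡ take m xs ++ [ y ]
take-suc-⊎ zero    []       = inj₁ refl
take-suc-⊎ zero    (x ∷ xs) = inj₂ (x , refl)
take-suc-⊎ (suc m) []       = inj₁ refl
take-suc-⊎ (suc m) (x ∷ xs) with take-suc-⊎ m xs
... | inj₁ eq       = inj₁ (cong (x ∷_) eq)
... | inj₂ (y , eq) = inj₂ (y , cong (x ∷_) eq)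

Unique∧All≡⇒length≤1 : ∀ {A : Set} {a : A} (xs : List A) → Unique xs → All (_≡ a) xs → length xs ≤ 1
Unique∧All≡⇒length≤1 []          _                    _                   = z≤n
Unique∧All≡⇒length≤1 (_ ∷ [])    _                    _                   = s≤s z≤n
Unique∧All≡⇒length≤1 (_ ∷ _ ∷ _) ((x≢y All.∷ _) ∷ _) (x≡a All.∷ y≡a All.∷ _) =
  ⊥-elim (x≢y (trans x≡a (sym y≡a)))

filter-upTo-length≤1 : ∀ {P : Pred ℕ 0ℓ} (P? : Decidable P) (n i : ℕ) →
  (∀ p → P p → p ≡ i) → length (filter P? (upTo n)) ≤ 1
filter-upTo-length≤1 P? n i onlyAt-i =
  Unique∧All≡⇒length≤1 _ (filter⁺ P? (upTo⁺ n))
    (All.tabulate λ {p} p∈ → onlyAt-i p (proj₂ (∈-filter⁻ P? {xs = upTo n} p∈)))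

freq≤1 : ∀ {k} (T S : List (Char k)) (i : ℕ) → (∀ p → OccursAt T S p → p ≡ i) → freq T S ≤ 1
freq≤1 T S = filter-upTo-length≤1 (occursAt? T S) (length T)

∈-allChars : ∀ {k} (y : Char k) → y ∈ allChars k
∈-allChars nothing  = here refl
∈-allChars (just c) = there (∈-map⁺ just (∈-allFin c))

length≡0⇒∉ : ∀ {A : Set} {x : A} (xs : List A) → length xs ≡ 0 → x ∉ xs
length≡0⇒∉ []      _  ()
length≡0⇒∉ (_ ∷ _) () _

rightSet-empty : ∀ {k} (T S : List (Char k)) → length (rightSet T S) ≡ 0 →
  ∀ y → ¬ freq T (S ++ [ y ]) ≡ 1
rightSet-empty T S r≡0 y f≡1 = length≡0⇒∉ (rightSet T S) r≡0
  (∈-filter⁺ (λ y → freq T (S ++ [ y ]) ≟ℕ 1) (∈-allChars y) f≡1)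

rightCond-extension : ∀ {k} (T S : List (Char k)) (i : ℕ) → OccursAt T S i →
  freq T (take (suc (length S)) (drop i T)) ≡ 1 → freq T S ≡ 1 ⊎ ∃ λ y → freq T (S ++ [ y ]) ≡ 1
rightCond-extension T S i (_ , occ) f≡1 with take-suc-⊎ (length S) (drop i T)
... | inj₁ eq       = inj₁ (subst (λ U → freq T U ≡ 1) (trans eq occ) f≡1)
... | inj₂ (y , eq) = inj₂ (y , subst (λ U → freq T U ≡ 1) (trans eq (cong (_++ [ y ]) occ)) f≡1)

module _ {k : ℕ} where

  text : List (Fin k) → List (Char k)
  text w = map just w ++ [ $ ]

  length-text : ∀ w → length (text w) ≡ suc (length w)
  length-text []      = refl
  length-text (_ ∷ w) = cong suc (length-text w)

  $∉take : ∀ w m → m ≤ length w → $ ∉ take m (text w)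
  $∉take _       zero    _         ()
  $∉take (_ ∷ w) (suc m) _         (here ())
  $∉take (_ ∷ w) (suc m) (s≤s m≤w) (there $∈) = $∉take w m m≤w $∈

  $∉take-drop : ∀ w p m → p + m ≤ length w → $ ∉ take m (drop p (text w))
  $∉take-drop w       zero    m m≤w   = $∉take w m m≤w
  $∉take-drop (_ ∷ w) (suc p) m (s≤s p+m≤w) = $∉take-drop w p m p+m≤w

  $∈take : ∀ w → $ ∈ take (suc (length w)) (text w)
  $∈take []      = here refl
  $∈take (_ ∷ w) = there ($∈take w)

  $∈take-drop : ∀ w i m → i + suc m ≡ suc (length w) → $ ∈ take (suc m) (drop i (text w))
  $∈take-drop w       zero    m refl = $∈take w
  $∈take-drop (_ ∷ w) (suc i) m eq   = $∈take-drop w i m (cong pred eq)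
  $∈take-drop []      (suc zero)    m ()
  $∈take-drop []      (suc (suc i)) m ()

  suffix-occursAt-unique : ∀ w s S i → i + length (s ∷ S) ≡ length (text w) →
    OccursAt (text w) (s ∷ S) i → ∀ p → OccursAt (text w) (s ∷ S) p → p ≡ i
  suffix-occursAt-unique w s S i i+m≡n (_ , occ-i) p (p+m≤n , occ-p)
    with m≤n⇒m<n∨m≡n (subst (p + suc (length S) ≤_) (length-text w) p+m≤n)
  ... | inj₁ p+m<n = ⊥-elim ($∉take-drop w p (suc (length S)) (≤-pred p+m<n)
          (subst ($ ∈_) (trans occ-i (sym occ-p))
            ($∈take-drop w i (length S) (trans i+m≡n (length-text w)))))
  ... | inj₂ p+m≡n = +-cancelʳ-≡ (suc (length S)) p i
          (trans p+m≡n (sym (trans i+m≡n (length-text w))))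

  suffix-freq≤1 : ∀ w S i → i < length (text w) → i + length S ≡ length (text w) →
    OccursAt (text w) S i → freq (text w) S ≤ 1
  suffix-freq≤1 w []      i i<n i≡n _   = ⊥-elim (<-irrefl (trans (sym (+-identityʳ i)) i≡n) i<n)
  suffix-freq≤1 w (s ∷ S) i _   i+m≡n occ =
    freq≤1 (text w) (s ∷ S) i (suffix-occursAt-unique w s S i i+m≡n occ)

corollary1 : {k : ℕ} (T S : List (Char k)) →
    SentinelText T →
    length (rightSet T S) ≡ 0 →
    netFreq T S ≡ 0
corollary1 T S (w , refl) r≡0 =
  cong length (filter-none (netOcc? T S) (All.tabulate λ i∈ → ¬netOcc (∈-upTo⁻ i∈)))
  where
  ¬netOcc : ∀ {i} → i < length T → ¬ NetOcc T S i
  ¬netOcc {i} i<n (occ , f≥2 , _ , inj₁ i+m≡n) = <⇒≱ f≥2 (suffix-freq≤1 w S i i<n i+m≡n occ)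
  ¬netOcc {i} _   (occ , f≥2 , _ , inj₂ ext≡1) with rightCond-extension T S i occ ext≡1
  ... | inj₁ f≡1       = <⇒≱ f≥2 (≤-reflexive f≡1)
  ... | inj₂ (y , f≡1) = rightSet-empty T S r≡0 y f≡1
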